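{- Let $C\ge 1$ be an integer, let $H=(L,F)$ be a finite directed graph in which every node has indegree at most $C$, and let $d\in\mathbb Z_{\ge0}$. Then there is a function $\tau:L\times\{0,1,\ldots,d\}\to\mathbb Z_{\ge0}$ such that: (1) for every $v\in L$, $\displaystyle\sum_{\substack{u\in L,\ 0\le r\le d\\ v\in B^+(u,r)}}\tau(u,r)=\sum_{i=0}^d C^i$; (2) for every $v\in L$, $\displaystyle\sum_{\substack{u\in L,\ 0\le r\le d\\ v\in \partial B^+(u,r)}}\tau(u,r)=C^d$; (3) $\tau(u,r)\le C^{d-r}$ for every $u\in L$ and $0\le r\le d$.
   Context: For nodes $u,v$ of $H$, $d_H(u,v)$ denotes the number of edges in a shortest directed path from $u$ to $v$ in $H$ ($\infty$ if none exists; $d_H(u,u)=0$). For $u\in L$ and $r\ge 0$, the directed ball is $B^+(u,r)=\{v\in L: d_H(u,v)\le r\}$ and its boundary is $\partial B^+(u,r)=\{v\in L: d_H(u,v)=r\}$. -}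

module Defs where

open import Data.Nat using (ℕ; zero; suc; _+_; _*_; _^_; _∸_)
open import Data.Fin using (Fin; zero; suc; toℕ)
open import Data.Bool using (Bool; true; false; _∧_; _∨_; not; if_then_else_)

ΣFin : (n : ℕ) → (Fin n → ℕ) → ℕ
ΣFin zero    f = 0
ΣFin (suc n) f = f zero + ΣFin n (λ i → f (suc i))

anyFin : (n : ℕ) → (Fin n → Bool) → Bool
anyFin zero    p = false
anyFin (suc n) p = p zero ∨ anyFin n (λ i → p (suc i))

_==_ : ∀ {n} → Fin n → Fin n → Bool
zero  == zero  = true
zero  == suc _ = false
suc _ == zero  = false
suc i == suc j = i == j

-- A finite directed graph H = (L, F) with node set L = Fin n and
-- arc relation E u v = true iff (u , v) ∈ F.
Digraph : ℕ → Set
Digraph n = Fin n → Fin n → Bool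

indeg : ∀ {n} → Digraph n → Fin n → ℕ
indeg {n} E v = ΣFin n (λ u → if E u v then 1 else 0)

-- inBall E r u v = true  iff  d_H(u,v) ≤ r, i.e. v ∈ B⁺(u,r)
-- (v is reachable from u by a directed walk with at most r arcs).
inBall : ∀ {n} → Digraph n → ℕ → Fin n → Fin n → Bool
inBall         E zero    u v = u == v
inBall {n} E (suc r) u v = inBall E r u v ∨ anyFin n (λ w → inBall E r u w ∧ E w v)

onBoundary : ∀ {n} → Digraph n → ℕ → Fin n → Fin n → Bool
onBoundary E zero    u v = inBall E zero u v
onBoundary E (suc r) u v = inBall E (suc r) u v ∧ not (inBall E r u v)

ΣWhere : ∀ {n} (d : ℕ) → (Fin n → Fin (suc d) → Bool) → (Fin n → Fin (suc d) → ℕ) → ℕ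
ΣWhere {n} d P τ = ΣFin n (λ u → ΣFin (suc d) (λ r → if P u r then τ u r else 0))

geomSum : ℕ → ℕ → ℕ
geomSum C zero    = 1
geomSum C (suc d) = geomSum C d + C ^ suc d

-- Build τ by induction on d. Shifting τ_d one radius outwards (τ_{d+1}(u,r+1) = τ_d(u,r))
-- keeps every ball sum and moves the boundary mass X(v) of radius r to radius r+1; it only
-- remains to put τ_{d+1}(v,0) = C^{d+1} − X(v). This is a natural number because every node
-- at distance r+1 from u has an in-neighbour at distance r, so X(v) is at most the sum of the
-- old boundary sums C^d over the ≤ C in-neighbours of v. Ball sums then grow by C^{d+1}.
module Submission where

open import Defs
open import Data.Nat using (ℕ; zero; suc; _+_; _*_; _≤_; _^_; _∸_; z≤n)
open import Data.Nat.Properties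
open import Data.Fin using (Fin; toℕ; zero; suc)
open import Data.Bool using (Bool; true; false; _∧_; _∨_; not; if_then_else_)
open import Data.Product using (Σ; _×_; _,_; ∃; proj₁)
open import Algebra.Properties.CommutativeSemigroup +-commutativeSemigroup using (interchange)
open import Relation.Binary.PropositionalEquality

ΣFin-cong : ∀ n {f g : Fin n → ℕ} → (∀ i → f i ≡ g i) → ΣFin n f ≡ ΣFin n g
ΣFin-cong zero    f≗g = refl
ΣFin-cong (suc n) f≗g = cong₂ _+_ (f≗g zero) (ΣFin-cong n (λ i → f≗g (suc i)))

ΣFin-mono-≤ : ∀ n {f g : Fin n → ℕ} → (∀ i → f i ≤ g i) → ΣFin n f ≤ ΣFin n g
ΣFin-mono-≤ zero    f≤g = z≤n
ΣFin-mono-≤ (suc n) f≤g = +-mono-≤ (f≤g zero) (ΣFin-mono-≤ n (λ i → f≤g (suc i)))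

ΣFin-0 : ∀ n → ΣFin n (λ _ → 0) ≡ 0
ΣFin-0 zero    = refl
ΣFin-0 (suc n) = ΣFin-0 n

ΣFin-+ : ∀ n (f g : Fin n → ℕ) → ΣFin n (λ i → f i + g i) ≡ ΣFin n f + ΣFin n g
ΣFin-+ zero    f g = refl
ΣFin-+ (suc n) f g = trans (cong (f zero + g zero +_) (ΣFin-+ n _ _))
  (interchange (f zero) (g zero) (ΣFin n (λ i → f (suc i))) (ΣFin n (λ i → g (suc i))))

ΣFin-swap : ∀ n m (f : Fin n → Fin m → ℕ) →
  ΣFin n (λ i → ΣFin m (f i)) ≡ ΣFin m (λ j → ΣFin n (λ i → f i j))
ΣFin-swap zero    m f = sym (ΣFin-0 m)
ΣFin-swap (suc n) m f =
  trans (cong (ΣFin m (f zero) +_) (ΣFin-swap n m (λ i → f (suc i)))) (sym (ΣFin-+ m _ _))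

ΣFin-term-≤ : ∀ n (f : Fin n → ℕ) i → f i ≤ ΣFin n f
ΣFin-term-≤ (suc n) f zero    = m≤m+n _ _
ΣFin-term-≤ (suc n) f (suc i) = ≤-trans (ΣFin-term-≤ n (λ i → f (suc i)) i) (m≤n+m _ _)

ΣFin-== : ∀ n (f : Fin n → ℕ) v → ΣFin n (λ u → if u == v then f u else 0) ≡ f v
ΣFin-== (suc n) f zero    = trans (cong (f zero +_) (ΣFin-0 n)) (+-identityʳ _)
ΣFin-== (suc n) f (suc v) = ΣFin-== n (λ i → f (suc i)) v

ΣFin-if-const : ∀ n (b : Fin n → Bool) K →
  ΣFin n (λ i → if b i then K else 0) ≡ ΣFin n (λ i → if b i then 1 else 0) * K
ΣFin-if-const zero    b K = refl
ΣFin-if-const (suc n) b K with b zero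
... | true  = cong (K +_) (ΣFin-if-const n _ K)
... | false = ΣFin-if-const n _ K

ΣFin-if : ∀ n (c : Bool) (f : Fin n → ℕ) →
  ΣFin n (λ i → if c then f i else 0) ≡ (if c then ΣFin n f else 0)
ΣFin-if n true  f = refl
ΣFin-if n false f = ΣFin-0 n

if-mono-≤ : ∀ (c : Bool) {x y : ℕ} → x ≤ y → (if c then x else 0) ≤ (if c then y else 0)
if-mono-≤ true  x≤y = x≤y
if-mono-≤ false x≤y = z≤n

if-∨-split : ∀ (a b : Bool) t →
  (if a ∨ b then t else 0) ≡ (if (a ∨ b) ∧ not a then t else 0) + (if a then t else 0)
if-∨-split true  b     t = refl
if-∨-split false true  t = sym (+-identityʳ t)
if-∨-split false false t = refl

∧-true : ∀ {a b} → a ∧ b ≡ true → a ≡ true × b ≡ true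
∧-true {true} {true} _ = refl , refl

anyFin-intro : ∀ n (p : Fin n → Bool) i → p i ≡ true → anyFin n p ≡ true
anyFin-intro (suc n) p zero    pi rewrite pi = refl
anyFin-intro (suc n) p (suc i) pi with p zero
... | true  = refl
... | false = anyFin-intro n _ i pi

anyFin-elim : ∀ n (p : Fin n → Bool) → anyFin n p ≡ true → ∃ λ i → p i ≡ true
anyFin-elim (suc n) p any with p zero in p0
... | true  = zero , p0
... | false with anyFin-elim n (λ i → p (suc i)) any
... | i , pi = suc i , pi

ΣWhere-∨ : ∀ {n} d (τ : Fin n → Fin (suc d) → ℕ) (a b : Fin n → Fin (suc d) → Bool) →
  ΣWhere d (λ u r → a u r ∨ b u r) τ
    ≡ ΣWhere d (λ u r → (a u r ∨ b u r) ∧ not (a u r)) τ + ΣWhere d a τ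
ΣWhere-∨ {n} d τ a b = trans (ΣFin-cong n split-row) (ΣFin-+ n (row a∨b∧¬a) (row a))
  where
  a∨b∧¬a : Fin n → Fin (suc d) → Bool
  a∨b∧¬a u r = (a u r ∨ b u r) ∧ not (a u r)
  row : (Fin n → Fin (suc d) → Bool) → Fin n → ℕ
  row P u = ΣFin (suc d) (λ r → if P u r then τ u r else 0)
  split-row : ∀ u → row (λ u r → a u r ∨ b u r) u ≡ row a∨b∧¬a u + row a u
  split-row u = trans (ΣFin-cong (suc d) (λ r → if-∨-split (a u r) (b u r) (τ u r)))
    (ΣFin-+ (suc d) (λ r → if a∨b∧¬a u r then τ u r else 0) (λ r → if a u r then τ u r else 0))

ΣWhere-zero : ∀ {n} (P : Fin n → Fin 1 → Bool) (τ : Fin n → Fin 1 → ℕ) →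
  ΣWhere 0 P τ ≡ ΣFin n (λ u → if P u zero then τ u zero else 0)
ΣWhere-zero {n} P τ = ΣFin-cong n (λ u → +-identityʳ _)

ΣWhere-suc : ∀ {n} d (P : Fin n → Fin (suc (suc d)) → Bool) →
  (τ : Fin n → Fin (suc (suc d)) → ℕ) →
  ΣWhere (suc d) P τ
    ≡ ΣFin n (λ u → if P u zero then τ u zero else 0)
      + ΣWhere d (λ u r → P u (suc r)) (λ u r → τ u (suc r))
ΣWhere-suc {n} d P τ = ΣFin-+ n (λ u → if P u zero then τ u zero else 0)
  (λ u → ΣFin (suc d) (λ r → if P u (suc r) then τ u (suc r) else 0))

module _ {n : ℕ} (E : Digraph n) where

  inBall-step : ∀ r u w v → inBall E r u w ≡ true → E w v ≡ true → inBall E (suc r) u v ≡ true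
  inBall-step r u w v w∈B Ewv with inBall E r u v
  ... | true  = refl
  ... | false = anyFin-intro n (λ x → inBall E r u x ∧ E x v) w (cong₂ _∧_ w∈B Ewv)

  onBoundary-of-inBall : ∀ r u w v → inBall E r u w ≡ true → inBall E r u v ≡ false →
    E w v ≡ true → onBoundary E r u w ≡ true
  onBoundary-of-inBall zero    u w v w∈B v∉B Ewv = w∈B
  onBoundary-of-inBall (suc r) u w v w∈B v∉B Ewv with inBall E r u w in w∈B′
  ... | false = cong (_∧ true) w∈B
  ... | true  with () ← trans (sym (inBall-step r u w v w∈B′ Ewv)) v∉B

  onBoundary-predecessor : ∀ r u v → onBoundary E (suc r) u v ≡ true →
    ∃ λ w → E w v ≡ true × onBoundary E r u w ≡ true
  onBoundary-predecessor r u v v∈∂B with inBall E r u v in v∉B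
  ... | false with anyFin-elim n (λ w → inBall E r u w ∧ E w v) (∧-true v∈∂B .proj₁)
  ... | w , w∈B∧Ewv with ∧-true {inBall E r u w} w∈B∧Ewv
  ... | w∈B , Ewv = w , Ewv , onBoundary-of-inBall r u w v w∈B v∉B Ewv

  module _ (d : ℕ) (τ : Fin n → Fin (suc d) → ℕ) where

    ballMass boundaryMass outerBoundaryMass : Fin n → ℕ
    ballMass          v = ΣWhere d (λ u r → inBall E (toℕ r) u v) τ
    boundaryMass      v = ΣWhere d (λ u r → onBoundary E (toℕ r) u v) τ
    outerBoundaryMass v = ΣWhere d (λ u r → onBoundary E (suc (toℕ r)) u v) τ

    ballMass-grow : ∀ v →
      ΣWhere d (λ u r → inBall E (suc (toℕ r)) u v) τ ≡ outerBoundaryMass v + ballMass v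
    ballMass-grow v = ΣWhere-∨ d τ (λ u r → inBall E (toℕ r) u v)
      (λ u r → anyFin n (λ w → inBall E (toℕ r) u w ∧ E w v))

    onBoundary-suc-≤ : ∀ t u v r → (if onBoundary E (suc r) u v then t else 0)
      ≤ ΣFin n (λ w → if E w v then (if onBoundary E r u w then t else 0) else 0)
    onBoundary-suc-≤ t u v r with onBoundary E (suc r) u v in v∈∂B
    ... | false = z≤n
    ... | true with onBoundary-predecessor r u v v∈∂B
    ... | w , Ewv , w∈∂B = ≤-trans (≤-reflexive (sym term-w)) (ΣFin-term-≤ n _ w)
      where
      term-w : (if E w v then (if onBoundary E r u w then t else 0) else 0) ≡ t
      term-w rewrite Ewv | w∈∂B = refl

    outerBoundaryMass-≤ : ∀ K → (∀ w → boundaryMass w ≤ K) →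
      ∀ v → outerBoundaryMass v ≤ indeg E v * K
    outerBoundaryMass-≤ K bound v = begin
      outerBoundaryMass v
        ≤⟨ ΣFin-mono-≤ n (λ u → ΣFin-mono-≤ (suc d) (λ r →
             onBoundary-suc-≤ (τ u r) u v (toℕ r))) ⟩
      ΣFin n (λ u → ΣFin (suc d) (λ r → ΣFin n (λ w → g w u r)))
        ≡⟨ ΣFin-cong n (λ u → ΣFin-swap (suc d) n (λ r w → g w u r)) ⟩
      ΣFin n (λ u → ΣFin n (λ w → ΣFin (suc d) (g w u)))
        ≡⟨ ΣFin-swap n n (λ u w → ΣFin (suc d) (g w u)) ⟩
      ΣFin n (λ w → ΣFin n (λ u → ΣFin (suc d) (g w u)))
        ≡⟨ ΣFin-cong n (λ w → trans (ΣFin-cong n (λ u → ΣFin-if (suc d) (E w v) (h w u)))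
                                    (ΣFin-if n (E w v) _)) ⟩
      ΣFin n (λ w → if E w v then boundaryMass w else 0)
        ≤⟨ ΣFin-mono-≤ n (λ w → if-mono-≤ (E w v) (bound w)) ⟩
      ΣFin n (λ w → if E w v then K else 0)
        ≡⟨ ΣFin-if-const n (λ w → E w v) K ⟩
      indeg E v * K ∎
      where
      open ≤-Reasoning
      h : Fin n → Fin n → Fin (suc d) → ℕ
      h w u r = if onBoundary E (toℕ r) u w then τ u r else 0
      g : Fin n → Fin n → Fin (suc d) → ℕ
      g w u r = if E w v then h w u r else 0

  IsBallWeighting : (C d : ℕ) → (Fin n → Fin (suc d) → ℕ) → Set
  IsBallWeighting C d τ =
    (∀ v → ballMass d τ v ≡ geomSum C d)
    × (∀ v → boundaryMass d τ v ≡ C ^ d)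
    × (∀ u r → τ u r ≤ C ^ (d ∸ toℕ r))

  module _ (C : ℕ) where

    ballWeights : (d : ℕ) → Fin n → Fin (suc d) → ℕ
    ballWeights zero    u r       = 1
    ballWeights (suc d) u zero    = C ^ suc d ∸ outerBoundaryMass d (ballWeights d) u
    ballWeights (suc d) u (suc r) = ballWeights d u r

    ballWeights-isBallWeighting : (∀ v → indeg E v ≤ C) →
      ∀ d → IsBallWeighting C d (ballWeights d)
    ballWeights-isBallWeighting indeg≤C zero =
      (λ v → trans (ΣWhere-zero (λ u r → inBall E (toℕ r) u v) (ballWeights 0))
                   (ΣFin-== n (λ _ → 1) v)) ,
      (λ v → trans (ΣWhere-zero (λ u r → onBoundary E (toℕ r) u v) (ballWeights 0))
                   (ΣFin-== n (λ _ → 1) v)) ,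
      λ { u zero → ≤-refl }
    ballWeights-isBallWeighting indeg≤C (suc d)
      with ballWeights-isBallWeighting indeg≤C d
    ... | ball≡ , boundary≡ , bounded = ball≡′ , boundary≡′ , bounded′
      where
      τ₀ : Fin n → ℕ
      τ₀ u = ballWeights (suc d) u zero

      X : Fin n → ℕ
      X = outerBoundaryMass d (ballWeights d)

      τ₀+X : ∀ v → τ₀ v + X v ≡ C ^ suc d
      τ₀+X v = m∸n+n≡m (≤-trans
        (outerBoundaryMass-≤ d (ballWeights d) (C ^ d) (λ w → ≤-reflexive (boundary≡ w)) v)
        (*-monoˡ-≤ (C ^ d) (indeg≤C v)))

      boundary≡′ : ∀ v → boundaryMass (suc d) (ballWeights (suc d)) v ≡ C ^ suc d
      boundary≡′ v = begin
        boundaryMass (suc d) (ballWeights (suc d)) v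
          ≡⟨ ΣWhere-suc d (λ u r → onBoundary E (toℕ r) u v) (ballWeights (suc d)) ⟩
        ΣFin n (λ u → if u == v then τ₀ u else 0) + X v
          ≡⟨ cong (_+ X v) (ΣFin-== n τ₀ v) ⟩
        τ₀ v + X v
          ≡⟨ τ₀+X v ⟩
        C ^ suc d ∎
        where open ≡-Reasoning

      ball≡′ : ∀ v → ballMass (suc d) (ballWeights (suc d)) v ≡ geomSum C (suc d)
      ball≡′ v = begin
        ballMass (suc d) (ballWeights (suc d)) v
          ≡⟨ ΣWhere-suc d (λ u r → inBall E (toℕ r) u v) (ballWeights (suc d)) ⟩
        ΣFin n (λ u → if u == v then τ₀ u else 0)
          + ΣWhere d (λ u r → inBall E (suc (toℕ r)) u v) (ballWeights d)
          ≡⟨ cong₂ _+_ (ΣFin-== n τ₀ v) (ballMass-grow d (ballWeights d) v) ⟩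
        τ₀ v + (X v + ballMass d (ballWeights d) v)
          ≡⟨ sym (+-assoc (τ₀ v) (X v) _) ⟩
        τ₀ v + X v + ballMass d (ballWeights d) v
          ≡⟨ cong₂ _+_ (τ₀+X v) (ball≡ v) ⟩
        C ^ suc d + geomSum C d
          ≡⟨ +-comm (C ^ suc d) _ ⟩
        geomSum C (suc d) ∎
        where open ≡-Reasoning

      bounded′ : ∀ u r → ballWeights (suc d) u r ≤ C ^ (suc d ∸ toℕ r)
      bounded′ u zero    = m∸n≤m (C ^ suc d) (X u)
      bounded′ u (suc r) = bounded u r

theorem5 : (C : ℕ) → 1 ≤ C → (n : ℕ) → (E : Digraph n) →
    ((v : Fin n) → indeg E v ≤ C) → (d : ℕ) →
    Σ (Fin n → Fin (suc d) → ℕ) (λ τ →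
      ((v : Fin n) → ΣWhere d (λ u r → inBall E (toℕ r) u v) τ ≡ geomSum C d)
      × ((v : Fin n) → ΣWhere d (λ u r → onBoundary E (toℕ r) u v) τ ≡ C ^ d)
      × ((u : Fin n) → (r : Fin (suc d)) → τ u r ≤ C ^ (d ∸ toℕ r)))
theorem5 C _ n E indeg≤C d = ballWeights E C d , ballWeights-isBallWeighting E C indeg≤C d
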